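{- Let $S=(N,M_0)$ be a Petri net system satisfying property $\mathcal{R}$ (i.e. $S$ and $-S$ are both reversible) and such that its potential reachability graph is initially directed, i.e. for every $M_1\in PR(S)$ we have $R(S)\cap R(N,M_1)\neq\emptyset$. Then $R(S)=PR(S)$.
   Context: A Petri net is $N=(P,T,W)$ with finite disjoint sets $P$, $T$ and $W:(P\times T)\cup(T\times P)\to\mathbb{N}$. A marking is $M\in\mathbb{N}^P$; a system is $(N,M_0)$. The incidence matrix is $I(p,t)=W(t,p)-W(p,t)$. A transition $t$ is enabled at $M$ if $M(p)\ge W(p,t)$ for all $p$, and firing it leads to $M+I(\cdot,t)$. $R(N,M)$ is the set of markings reachable from $M$ by finite firing sequences, and $R(S)=R(N,M_0)$. $PR(S)=\{M\in\mathbb{N}^P\mid \exists Y\in\mathbb{N}^T,\ M=M_0+I\cdot Y\}$. A system is reversible if its initial marking is reachable from each of its reachable markings. The reverse net $-N$ reverses all arcs keeping weights, and $-S=(-N,M_0)$; property $\mathcal{R}$ means both $S$ and $-S$ are reversible. -}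

module Defs where

open import Data.Nat using (ℕ; _≤_; _+_; _∸_)
open import Data.Integer as ℤ using (ℤ; +_; _-_)
open import Data.Fin using (Fin)
open import Data.Product using (Σ; ∃; _×_; _,_)
open import Relation.Binary.PropositionalEquality using (_≡_)

record Net (np nt : ℕ) : Set where
  field
    Wpt : Fin np → Fin nt → ℕ
    Wtp : Fin nt → Fin np → ℕ
open Net public

Marking : ℕ → Set
Marking np = Fin np → ℕ

reverse : ∀ {np nt} → Net np nt → Net np nt
reverse N = record { Wpt = λ p t → Wtp N t p ; Wtp = λ t p → Wpt N p t }

incidence : ∀ {np nt} → Net np nt → Fin np → Fin nt → ℤ
incidence N p t = + Wtp N t p - + Wpt N p t

Enabled : ∀ {np nt} → Net np nt → Marking np → Fin nt → Set
Enabled N M t = ∀ p → Wpt N p t ≤ M p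

-- result of firing t at M (meaningful when t is enabled): M + I(·,t)
fire : ∀ {np nt} → Net np nt → Marking np → Fin nt → Marking np
fire N M t p = (M p ∸ Wpt N p t) + Wtp N t p

data Reach {np nt} (N : Net np nt) (M : Marking np) : Marking np → Set where
  here : ∀ {M'} → (∀ p → M' p ≡ M p) → Reach N M M'
  step : ∀ {M₁ M'} (t : Fin nt) → Reach N M M₁ → Enabled N M₁ t →
         (∀ p → M' p ≡ fire N M₁ t p) → Reach N M M'

Σᶠ : ∀ {n} → (Fin n → ℤ) → ℤ
Σᶠ {ℕ.zero} f = + 0
Σᶠ {ℕ.suc n} f = f Fin.zero ℤ.+ Σᶠ (λ i → f (Fin.suc i))
  where import Data.Fin as Fin

PotReach : ∀ {np nt} → Net np nt → Marking np → Marking np → Set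
PotReach {np} {nt} N M₀ M =
  Σ (Fin nt → ℕ) λ Y → ∀ p → + M p ≡ + M₀ p ℤ.+ Σᶠ (λ t → incidence N p t ℤ.* + Y t)

Reversible : ∀ {np nt} → Net np nt → Marking np → Set
Reversible N M₀ = ∀ M → Reach N M₀ M → Reach N M M₀

PropertyR : ∀ {np nt} → Net np nt → Marking np → Set
PropertyR N M₀ = Reversible N M₀ × Reversible (reverse N) M₀

InitiallyDirected : ∀ {np nt} → Net np nt → Marking np → Set
InitiallyDirected N M₀ =
  ∀ M₁ → PotReach N M₀ M₁ → ∃ λ M → Reach N M₀ M × Reach N M₁ M

-- Reachability implies potential reachability by the state equation. Conversely,
-- if M₁ is potentially reachable, pick M reachable from both M₀ and M₁. Reversing
-- firing sequences, M₀ reaches M (reversibility of S) and then M₁ in −N; so M₁ is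
-- reachable in −S, hence reaches M₀ in −N by reversibility of −S, i.e. M₀ reaches M₁ in N.
module Submission where

open import Defs
open import Data.Nat using (ℕ; zero; suc; _∸_)
import Data.Nat as ℕ
import Data.Nat.Properties as ℕ
open import Data.Integer as ℤ using (ℤ; +_; _-_; _⊖_)
import Data.Integer.Properties as ℤ
open import Data.Integer.Solver using (module +-*-Solver)
open import Data.Fin using (Fin)
import Data.Fin as Fin
open import Data.Product using (_×_; _,_)
open import Relation.Binary.PropositionalEquality
open ≡-Reasoning
open +-*-Solver

Reach-cong : ∀ {np nt} {N : Net np nt} {A B C : Marking np} →
  Reach N A B → (∀ p → C p ≡ B p) → Reach N A C
Reach-cong (here B≡A) C≡B = here (λ p → trans (C≡B p) (B≡A p))
Reach-cong (step t r en B≡M′) C≡B = step t r en (λ p → trans (C≡B p) (B≡M′ p))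

Reach-trans : ∀ {np nt} {N : Net np nt} {A B C : Marking np} →
  Reach N A B → Reach N B C → Reach N A C
Reach-trans r (here C≡B) = Reach-cong r C≡B
Reach-trans r (step t r′ en C≡M′) = step t (Reach-trans r r′) en C≡M′

module _ {np nt} {N : Net np nt} where

  fire-enabled-reverse : ∀ {M t} → Enabled (reverse N) (fire N M t) t
  fire-enabled-reverse {M} {t} p = ℕ.m≤n+m (Wtp N t p) (M p ∸ Wpt N p t)

  fire-reverse-fire : ∀ {M t} → Enabled N M t → ∀ p → fire (reverse N) (fire N M t) t p ≡ M p
  fire-reverse-fire {M} {t} en p = begin
    ((M p ∸ Wpt N p t) ℕ.+ Wtp N t p ∸ Wtp N t p) ℕ.+ Wpt N p t
      ≡⟨ cong (ℕ._+ Wpt N p t) (ℕ.m+n∸n≡m (M p ∸ Wpt N p t) (Wtp N t p)) ⟩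
    (M p ∸ Wpt N p t) ℕ.+ Wpt N p t
      ≡⟨ ℕ.m∸n+n≡m (en p) ⟩
    M p ∎

  fire-undo : ∀ {M B t} → Enabled N M t → (∀ p → B p ≡ fire N M t p) → Reach (reverse N) B M
  fire-undo {M} {B} {t} en B≡M′ = step t (here (λ _ → refl))
    (λ p → subst (Wtp N t p ℕ.≤_) (sym (B≡M′ p)) (fire-enabled-reverse {M} p))
    (λ p → trans (sym (fire-reverse-fire en p))
                 (cong (λ m → (m ∸ Wtp N t p) ℕ.+ Wpt N p t) (sym (B≡M′ p))))

  Reach-reverse : ∀ {A B : Marking np} → Reach N A B → Reach (reverse N) B A
  Reach-reverse (here B≡A)          = here (λ p → sym (B≡A p))
  Reach-reverse (step t r en B≡M′) = Reach-trans (fire-undo en B≡M′) (Reach-reverse r)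

increment : ∀ {n} → Fin n → (Fin n → ℕ) → Fin n → ℕ
increment Fin.zero    Y Fin.zero    = suc (Y Fin.zero)
increment Fin.zero    Y (Fin.suc s) = Y (Fin.suc s)
increment (Fin.suc t) Y Fin.zero    = Y Fin.zero
increment (Fin.suc t) Y (Fin.suc s) = increment t (λ i → Y (Fin.suc i)) s

Σᶠ-*-zeroʳ : ∀ {n} (c : Fin n → ℤ) → Σᶠ (λ s → c s ℤ.* + 0) ≡ + 0
Σᶠ-*-zeroʳ {zero}  c = refl
Σᶠ-*-zeroʳ {suc n} c = cong₂ ℤ._+_ (ℤ.*-zeroʳ (c Fin.zero)) (Σᶠ-*-zeroʳ (λ s → c (Fin.suc s)))

Σᶠ-*-increment : ∀ {n} (c : Fin n → ℤ) (Y : Fin n → ℕ) (t : Fin n) →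
  Σᶠ (λ s → c s ℤ.* + increment t Y s) ≡ c t ℤ.+ Σᶠ (λ s → c s ℤ.* + Y s)
Σᶠ-*-increment c Y Fin.zero =
  solve 3 (λ x y r → x :* (con (+ 1) :+ y) :+ r := x :+ (x :* y :+ r)) refl
    (c Fin.zero) (+ Y Fin.zero) (Σᶠ (λ s → c (Fin.suc s) ℤ.* + Y (Fin.suc s)))
Σᶠ-*-increment c Y (Fin.suc t) = begin
  c₀y₀ ℤ.+ Σᶠ (λ s → c (Fin.suc s) ℤ.* + increment t Y′ s)
    ≡⟨ cong (λ x → c₀y₀ ℤ.+ x) (Σᶠ-*-increment (λ s → c (Fin.suc s)) Y′ t) ⟩
  c₀y₀ ℤ.+ (c (Fin.suc t) ℤ.+ rest)
    ≡⟨ solve 3 (λ a b r → a :+ (b :+ r) := b :+ (a :+ r)) refl c₀y₀ (c (Fin.suc t)) rest ⟩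
  c (Fin.suc t) ℤ.+ (c₀y₀ ℤ.+ rest) ∎
  where
  Y′ = λ i → Y (Fin.suc i)
  c₀y₀ = c Fin.zero ℤ.* + Y Fin.zero
  rest = Σᶠ (λ s → c (Fin.suc s) ℤ.* + Y′ s)

fire-incidence : ∀ {np nt} (N : Net np nt) {M t} → Enabled N M t →
  ∀ p → + fire N M t p ≡ + M p ℤ.+ incidence N p t
fire-incidence N {M} {t} en p = begin
  + ((M p ∸ Wpt N p t) ℕ.+ Wtp N t p)   ≡⟨ ℤ.pos-+ (M p ∸ Wpt N p t) (Wtp N t p) ⟩
  + (M p ∸ Wpt N p t) ℤ.+ + Wtp N t p   ≡⟨ cong (ℤ._+ + Wtp N t p) (sym (ℤ.⊖-≥ (en p))) ⟩
  (M p ⊖ Wpt N p t) ℤ.+ + Wtp N t p     ≡⟨ cong (ℤ._+ + Wtp N t p) (sym (ℤ.[+m]-[+n]≡m⊖n (M p) (Wpt N p t))) ⟩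
  (+ M p - + Wpt N p t) ℤ.+ + Wtp N t p
    ≡⟨ solve 3 (λ m w v → (m :- w) :+ v := m :+ (v :- w)) refl (+ M p) (+ Wpt N p t) (+ Wtp N t p) ⟩
  + M p ℤ.+ incidence N p t ∎

Reach⇒PotReach : ∀ {np nt} (N : Net np nt) {M₀ M : Marking np} → Reach N M₀ M → PotReach N M₀ M
Reach⇒PotReach N {M₀} (here M≡M₀) = (λ _ → 0) , λ p → begin
  + _                                          ≡⟨ cong +_ (M≡M₀ p) ⟩
  + M₀ p                                       ≡⟨ sym (ℤ.+-identityʳ (+ M₀ p)) ⟩
  + M₀ p ℤ.+ + 0                               ≡⟨ cong (λ x → + M₀ p ℤ.+ x) (sym (Σᶠ-*-zeroʳ (incidence N p))) ⟩
  + M₀ p ℤ.+ Σᶠ (λ s → incidence N p s ℤ.* + 0) ∎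
Reach⇒PotReach N {M₀} {M} (step {M₁} t r en M≡M′) with Reach⇒PotReach N r
... | Y , stateY = increment t Y , λ p →
  let S = Σᶠ (λ s → incidence N p s ℤ.* + Y s) in begin
  + M p                                        ≡⟨ cong +_ (M≡M′ p) ⟩
  + fire N M₁ t p                              ≡⟨ fire-incidence N en p ⟩
  + M₁ p ℤ.+ incidence N p t                   ≡⟨ cong (ℤ._+ incidence N p t) (stateY p) ⟩
  + M₀ p ℤ.+ S ℤ.+ incidence N p t
    ≡⟨ solve 3 (λ a s i → a :+ s :+ i := a :+ (i :+ s)) refl (+ M₀ p) S (incidence N p t) ⟩
  + M₀ p ℤ.+ (incidence N p t ℤ.+ S)           ≡⟨ cong (λ x → + M₀ p ℤ.+ x) (sym (Σᶠ-*-increment (incidence N p) Y t)) ⟩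
  + M₀ p ℤ.+ Σᶠ (λ s → incidence N p s ℤ.* + increment t Y s) ∎

theorem2 : ∀ {np nt} (N : Net np nt) (M₀ : Marking np) →
    PropertyR N M₀ → InitiallyDirected N M₀ →
    (∀ M → (Reach N M₀ M → PotReach N M₀ M) × (PotReach N M₀ M → Reach N M₀ M))
theorem2 N M₀ (reversible , reversible⁻) directed M₁ = Reach⇒PotReach N , PotReach⇒Reach
  where
  PotReach⇒Reach : PotReach N M₀ M₁ → Reach N M₀ M₁
  PotReach⇒Reach pr with directed M₁ pr
  -- reverse (reverse N) is N by record η, so reversing a run of −N gives a run of N.
  ... | M , M₀→M , M₁→M = Reach-reverse (reversible⁻ M₁ M₁-in-−S)
    where
    M₁-in-−S : Reach (reverse N) M₀ M₁
    M₁-in-−S = Reach-trans (Reach-reverse (reversible M M₀→M)) (Reach-reverse M₁→M)
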